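{- Let $n$ be a positive integer such that $5\mid 2n^2+2n+1$, $8n+1$ is not a perfect square, and $8n-3\neq 5k^2$ for all $k\in\mathbb{Z}$. Let $m=(2n^2+2n+1)/5$ and let $C_5$ be the cyclic group of order $5$. Then there is no element $\overline{T}=\sum_{g\in C_5}a_g g\in\mathbb{Z}[C_5]$ with nonnegative integer coefficients and $\sum_g a_g=2n+1$ (i.e. a multiset of $2n+1$ elements of $C_5$) satisfying both (b') $\overline{T}=\overline{T}^{(-1)}$, and (c') $\overline{T}^2=2mC_5-\overline{T}^{(2)}+2n$ in $\mathbb{Z}[C_5]$.
   Context: In the group ring $\mathbb{Z}[C_5]$, $C_5$ denotes $\sum_{g\in C_5}g$, an integer $k$ denotes $k$ times the identity, and for $A=\sum_g a_g g$ and an integer $t$, $A^{(t)}=\sum_g a_g g^t$. -}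

module Defs where

open import Data.Nat as ℕ using (ℕ)
open import Data.Fin using (Fin; toℕ; fromℕ<)
open import Data.Integer as ℤ using (ℤ; +_; _+_; _*_; _-_; -_)
open import Data.Integer.DivMod using (_%ℕ_; n%ℕd<d)
open import Data.Nat.DivMod using (_%_; m%n<n)
open import Data.List using (List; map; foldr; allFin)
open import Data.Bool using (if_then_else_)
open import Data.Nat using (_≡ᵇ_)
open import Relation.Binary.PropositionalEquality using (_≡_)

-- The integral group ring Z[C_5]: an element  Σ_i a_i g^i  (g a fixed generator
-- of C_5) is represented by its coefficient function  i ↦ a_i.
ZC5 : Set
ZC5 = Fin 5 → ℤ

_⊕_ : Fin 5 → Fin 5 → Fin 5
i ⊕ j = fromℕ< (m%n<n (toℕ i ℕ.+ toℕ j) 5)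

powIdx : ℤ → Fin 5 → Fin 5
powIdx t i = fromℕ< (n%ℕd<d ((+ toℕ i) * t) 5)

Σ5 : (Fin 5 → ℤ) → ℤ
Σ5 f = foldr _+_ (+ 0) (map f (allFin 5))

[_≟ᵢ_] : Fin 5 → Fin 5 → ℤ → ℤ
[ i ≟ᵢ j ] z = if toℕ i ≡ᵇ toℕ j then z else + 0

_·_ : ZC5 → ZC5 → ZC5
(A · B) k = Σ5 (λ i → Σ5 (λ j → [ i ⊕ j ≟ᵢ k ] (A i * B j)))

_⊞_ : ZC5 → ZC5 → ZC5
(A ⊞ B) k = A k + B k

⊟_ : ZC5 → ZC5
(⊟ A) k = - A k

_⁽_⁾ : ZC5 → ℤ → ZC5
(A ⁽ t ⁾) k = Σ5 (λ i → [ powIdx t i ≟ᵢ k ] (A i))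

C5 : ZC5
C5 _ = + 1

ι : ℤ → ZC5
ι k i = [ i ≟ᵢ Data.Fin.zero ] k

_∙_ : ℤ → ZC5 → ZC5
(c ∙ A) i = c * A i

_≋_ : ZC5 → ZC5 → Set
A ≋ B = ∀ i → A i ≡ B i

-- A symmetric T = T^(-1) has coefficients x, y, z, z, y at 1, g, g², g³, g⁴, so (c') at g and at g²
-- gives two quadratic equations in x, y, z whose difference factors as
-- (y - z)(2x - 1 - y - z) = 0.  Together with x + 2y + 2z = 2n + 1 and 5m = 2n² + 2n + 1,
-- y = z forces 8n + 1 = (2x - 2z + 1)², while y + z = 2x - 1 forces 8n - 3 = 5(y - z)².
module Submission where

open import Defs
open import Data.Nat as ℕ using (ℕ; _≥_; _/_)
open import Data.Nat.Divisibility using (_∣_)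
open import Data.Nat.DivMod using (m*[n/m]≡n)
open import Data.Integer as ℤ using (ℤ; +_; -_; _+_; _*_; _-_; 0ℤ)
import Data.Integer.Properties as ℤP
open import Data.Integer.Tactic.RingSolver using (solve-∀; solve)
open import Data.Fin using (Fin; zero; suc; #_)
open import Data.List using ([]; _∷_; foldr; allFin)
open import Data.List.Properties using (map-cong)
open import Data.Product using (Σ; _×_; _,_; proj₁; proj₂)
open import Data.Sum as Sum using (_⊎_; [_,_])
open import Relation.Nullary using (¬_)
open import Relation.Binary.PropositionalEquality
  using (_≡_; _≢_; _≗_; refl; sym; trans; cong; cong₂; module ≡-Reasoning)

open ≡-Reasoning

Σ5-cong : {f g : Fin 5 → ℤ} → f ≗ g → Σ5 f ≡ Σ5 g
Σ5-cong f≗g = cong (foldr _+_ (+ 0)) (map-cong f≗g (allFin 5))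

·-cong : {A A′ B B′ : ZC5} → A ≋ A′ → B ≋ B′ → (A · B) ≋ (A′ · B′)
·-cong A≋A′ B≋B′ k =
  Σ5-cong λ i → Σ5-cong λ j → cong [ i ⊕ j ≟ᵢ k ] (cong₂ _*_ (A≋A′ i) (B≋B′ j))

⁽⁾-cong : {A B : ZC5} → A ≋ B → (t : ℤ) → (A ⁽ t ⁾) ≋ (B ⁽ t ⁾)
⁽⁾-cong A≋B t k = Σ5-cong λ i → cong [ powIdx t i ≟ᵢ k ] (A≋B i)

-- Unfolding the two Σ5's leaves, for each i, the single term with i ⊕ j = k, padded by zeros.
·-coeff₁ : (A B : ZC5) → (A · B) (# 1)
  ≡ A (# 0) * B (# 1) + A (# 1) * B (# 0) + A (# 2) * B (# 4) + A (# 3) * B (# 3) + A (# 4) * B (# 2)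
·-coeff₁ A B = unfold (A (# 0)) (A (# 1)) (A (# 2)) (A (# 3)) (A (# 4))
                      (B (# 0)) (B (# 1)) (B (# 2)) (B (# 3)) (B (# 4))
  where
  unfold : ∀ a₀ a₁ a₂ a₃ a₄ b₀ b₁ b₂ b₃ b₄ →
      + 0 + (a₀ * b₁ + + 0)
    + (a₁ * b₀ + + 0
    + (+ 0 + (+ 0 + (+ 0 + (+ 0 + (a₂ * b₄ + + 0))))
    + (+ 0 + (+ 0 + (+ 0 + (a₃ * b₃ + + 0)))
    + (+ 0 + (+ 0 + (a₄ * b₂ + + 0)) + + 0))))
    ≡ a₀ * b₁ + a₁ * b₀ + a₂ * b₄ + a₃ * b₃ + a₄ * b₂
  unfold = solve-∀

·-coeff₂ : (A B : ZC5) → (A · B) (# 2)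
  ≡ A (# 0) * B (# 2) + A (# 1) * B (# 1) + A (# 2) * B (# 0) + A (# 3) * B (# 4) + A (# 4) * B (# 3)
·-coeff₂ A B = unfold (A (# 0)) (A (# 1)) (A (# 2)) (A (# 3)) (A (# 4))
                      (B (# 0)) (B (# 1)) (B (# 2)) (B (# 3)) (B (# 4))
  where
  unfold : ∀ a₀ a₁ a₂ a₃ a₄ b₀ b₁ b₂ b₃ b₄ →
      + 0 + (+ 0 + (a₀ * b₂ + + 0))
    + (+ 0 + (a₁ * b₁ + + 0)
    + (a₂ * b₀ + + 0
    + (+ 0 + (+ 0 + (+ 0 + (+ 0 + (a₃ * b₄ + + 0))))
    + (+ 0 + (+ 0 + (+ 0 + (a₄ * b₃ + + 0))) + + 0))))
    ≡ a₀ * b₂ + a₁ * b₁ + a₂ * b₀ + a₃ * b₄ + a₄ * b₃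
  unfold = solve-∀

⁽-1⁾-coeff₃ : (A : ZC5) → (A ⁽ - + 1 ⁾) (# 3) ≡ A (# 2)
⁽-1⁾-coeff₃ A = trans (ℤP.+-identityˡ _) (trans (ℤP.+-identityˡ _) (ℤP.+-identityʳ _))

⁽-1⁾-coeff₄ : (A : ZC5) → (A ⁽ - + 1 ⁾) (# 4) ≡ A (# 1)
⁽-1⁾-coeff₄ A = trans (ℤP.+-identityˡ _) (ℤP.+-identityʳ _)

⁽2⁾-coeff₁ : (A : ZC5) → (A ⁽ + 2 ⁾) (# 1) ≡ A (# 3)
⁽2⁾-coeff₁ A =
  trans (ℤP.+-identityˡ _) (trans (ℤP.+-identityˡ _) (trans (ℤP.+-identityˡ _) (ℤP.+-identityʳ _)))

⁽2⁾-coeff₂ : (A : ZC5) → (A ⁽ + 2 ⁾) (# 2) ≡ A (# 1)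
⁽2⁾-coeff₂ A = trans (ℤP.+-identityˡ _) (ℤP.+-identityʳ _)

palindrome : ℤ → ℤ → ℤ → ZC5
palindrome x y z zero                          = x
palindrome x y z (suc zero)                    = y
palindrome x y z (suc (suc zero))              = z
palindrome x y z (suc (suc (suc zero)))        = z
palindrome x y z (suc (suc (suc (suc zero))))  = y

symmetric⇒palindrome : {A : ZC5} → A ≋ (A ⁽ - + 1 ⁾) → A ≋ palindrome (A (# 0)) (A (# 1)) (A (# 2))
symmetric⇒palindrome     A-sym zero                          = refl
symmetric⇒palindrome     A-sym (suc zero)                    = refl
symmetric⇒palindrome     A-sym (suc (suc zero))              = refl
symmetric⇒palindrome {A} A-sym (suc (suc (suc zero)))        = trans (A-sym _) (⁽-1⁾-coeff₃ A)
symmetric⇒palindrome {A} A-sym (suc (suc (suc (suc zero))))  = trans (A-sym _) (⁽-1⁾-coeff₄ A)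

Σ5-palindrome : ∀ x y z → Σ5 (palindrome x y z) ≡ x + + 2 * y + + 2 * z
Σ5-palindrome = unfold
  where
  unfold : ∀ x y z → x + (y + (z + (z + (y + + 0)))) ≡ x + + 2 * y + + 2 * z
  unfold = solve-∀

palindrome-square+⁽2⁾₁ : ∀ x y z → let P = palindrome x y z in
  (P · P) (# 1) + (P ⁽ + 2 ⁾) (# 1) ≡ + 2 * x * y + + 2 * y * z + z * z + z
palindrome-square+⁽2⁾₁ x y z = begin
  (P · P) (# 1) + (P ⁽ + 2 ⁾) (# 1)          ≡⟨ cong₂ _+_ (·-coeff₁ P P) (⁽2⁾-coeff₁ P) ⟩
  x * y + y * x + z * y + z * z + y * z + z  ≡⟨ solve (x ∷ y ∷ z ∷ []) ⟩
  + 2 * x * y + + 2 * y * z + z * z + z      ∎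
  where P = palindrome x y z

palindrome-square+⁽2⁾₂ : ∀ x y z → let P = palindrome x y z in
  (P · P) (# 2) + (P ⁽ + 2 ⁾) (# 2) ≡ + 2 * x * z + y * y + + 2 * y * z + y
palindrome-square+⁽2⁾₂ x y z = begin
  (P · P) (# 2) + (P ⁽ + 2 ⁾) (# 2)          ≡⟨ cong₂ _+_ (·-coeff₂ P P) (⁽2⁾-coeff₂ P) ⟩
  x * z + y * y + z * x + z * y + y * z + y  ≡⟨ solve (x ∷ y ∷ z ∷ []) ⟩
  + 2 * x * z + y * y + + 2 * y * z + y      ∎
  where P = palindrome x y z

-- At g ≠ 1 the right-hand side of (c') evaluates to c * 1 + (- t + 0).
balance : ∀ {s t c} → s ≡ c * + 1 + (- t + + 0) → s + t ≡ c
balance {t = t} {c} refl = solve (t ∷ c ∷ [])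

symmetric-solution⇒reduced-system : ∀ {T : ZC5} {c d} → T ≋ (T ⁽ - + 1 ⁾)
  → (T · T) ≋ ((c ∙ C5) ⊞ ((⊟ (T ⁽ + 2 ⁾)) ⊞ ι d))
  → let x = T (# 0); y = T (# 1); z = T (# 2) in
    (Σ5 T ≡ x + + 2 * y + + 2 * z)
    × (+ 2 * x * y + + 2 * y * z + z * z + z ≡ c)
    × (+ 2 * x * z + y * y + + 2 * y * z + y ≡ c)
symmetric-solution⇒reduced-system {T} T-sym T-square =
    trans (Σ5-cong T≋P) (Σ5-palindrome x y z)
  , trans (sym (via-palindrome (# 1) (palindrome-square+⁽2⁾₁ x y z))) (balance (T-square (# 1)))
  , trans (sym (via-palindrome (# 2) (palindrome-square+⁽2⁾₂ x y z))) (balance (T-square (# 2)))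
  where
  x = T (# 0); y = T (# 1); z = T (# 2)
  T≋P = symmetric⇒palindrome T-sym
  P = palindrome x y z
  via-palindrome : ∀ k {e} → (P · P) k + (P ⁽ + 2 ⁾) k ≡ e → (T · T) k + (T ⁽ + 2 ⁾) k ≡ e
  via-palindrome k = trans (cong₂ _+_ (·-cong T≋P T≋P k) (⁽⁾-cong T≋P (+ 2) k))

+-vanishing : ∀ {t} a b → t ≡ 0ℤ → a + t * b ≡ a
+-vanishing a b refl = ℤP.+-identityʳ a

module _ {x y z Q n : ℤ}
  (hS : x + + 2 * y + + 2 * z ≡ + 2 * n + + 1)
  (h₁ : + 2 * x * y + + 2 * y * z + z * z + z ≡ + 2 * Q)
  (h₂ : + 2 * x * z + y * y + + 2 * y * z + y ≡ + 2 * Q)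
  (hQ : + 5 * Q ≡ + 2 * n * n + + 2 * n + + 1)
  where

  coefficient-difference : (y - z) * (+ 2 * x - + 1 - y - z) ≡ 0ℤ
  coefficient-difference = begin
    (y - z) * (+ 2 * x - + 1 - y - z)
      ≡⟨ solve (x ∷ y ∷ z ∷ []) ⟩
    (+ 2 * x * y + + 2 * y * z + z * z + z) - (+ 2 * x * z + y * y + + 2 * y * z + y)
      ≡⟨ cong₂ _-_ h₁ h₂ ⟩
    + 2 * Q - + 2 * Q
      ≡⟨ ℤP.+-inverseʳ (+ 2 * Q) ⟩
    0ℤ ∎

  eliminate-Q : + 5 * (+ 2 * x * y + + 2 * y * z + z * z + z) ≡ + 2 * (+ 2 * n * n + + 2 * n + + 1)
  eliminate-Q = begin
    + 5 * (+ 2 * x * y + + 2 * y * z + z * z + z) ≡⟨ cong (+ 5 *_) h₁ ⟩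
    + 5 * (+ 2 * Q)                               ≡⟨ solve (Q ∷ []) ⟩
    + 2 * (+ 5 * Q)                               ≡⟨ cong (+ 2 *_) hQ ⟩
    + 2 * (+ 2 * n * n + + 2 * n + + 1)           ∎

  equal-case : y - z ≡ 0ℤ → + 8 * n + + 1 ≡ (+ 2 * x - + 2 * z + + 1) * (+ 2 * x - + 2 * z + + 1)
  equal-case y-z≡0 = begin
    + 8 * n + + 1
      ≡⟨ solve (n ∷ []) ⟩
    (+ 2 * (+ 2 * n + + 1) + + 1) * (+ 2 * (+ 2 * n + + 1) + + 1)
      - + 4 * (+ 2 * (+ 2 * n * n + + 2 * n + + 1))
      ≡⟨ cong₂ (λ s p → (+ 2 * s + + 1) * (+ 2 * s + + 1) - + 4 * p) hS eliminate-Q ⟨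
    (+ 2 * (x + + 2 * y + + 2 * z) + + 1) * (+ 2 * (x + + 2 * y + + 2 * z) + + 1)
      - + 4 * (+ 5 * (+ 2 * x * y + + 2 * y * z + z * z + z))
      ≡⟨ solve (x ∷ y ∷ z ∷ []) ⟩
    (+ 2 * x - + 2 * z + + 1) * (+ 2 * x - + 2 * z + + 1)
      + (y - z) * (+ 8 * (+ 2 * y + z - + 3 * x + + 1))
      ≡⟨ +-vanishing _ _ y-z≡0 ⟩
    (+ 2 * x - + 2 * z + + 1) * (+ 2 * x - + 2 * z + + 1) ∎

  opposite-case : + 2 * x - + 1 - y - z ≡ 0ℤ → + 8 * n - + 3 ≡ + 5 * (y - z) * (y - z)
  opposite-case e = begin
    + 8 * n - + 3
      ≡⟨ solve (n ∷ []) ⟩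
    + 4 * (+ 2 * n + + 1 + + 2) * (+ 2 * n + + 1 + + 2)
      - + 12 * (+ 2 * n + + 1 + + 2) + + 5 - + 4 * (+ 2 * (+ 2 * n * n + + 2 * n + + 1))
      ≡⟨ cong₂ (λ s p → + 4 * (s + + 2) * (s + + 2) - + 12 * (s + + 2) + + 5 - + 4 * p)
               hS eliminate-Q ⟨
    + 4 * (x + + 2 * y + + 2 * z + + 2) * (x + + 2 * y + + 2 * z + + 2)
      - + 12 * (x + + 2 * y + + 2 * z + + 2) + + 5 - + 4 * (+ 5 * (+ 2 * x * y + + 2 * y * z + z * z + z))
      ≡⟨ solve (x ∷ y ∷ z ∷ []) ⟩
    + 5 * (y - z) * (y - z) + (+ 2 * x - + 1 - y - z) * (+ 2 * x + + 3 - + 11 * y + + 9 * z)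
      ≡⟨ +-vanishing _ _ e ⟩
    + 5 * (y - z) * (y - z) ∎

  reduced-system⇒8n+1≡w²⊎8n-3≡5k² :
    (Σ ℤ λ w → w * w ≡ + 8 * n + + 1) ⊎ (Σ ℤ λ k → + 8 * n - + 3 ≡ + 5 * k * k)
  reduced-system⇒8n+1≡w²⊎8n-3≡5k² = Sum.map
    (λ y-z≡0 → + 2 * x - + 2 * z + + 1 , sym (equal-case y-z≡0))
    (λ e → y - z , opposite-case e)
    (ℤP.i*j≡0⇒i≡0∨j≡0 (y - z) coefficient-difference)

pos-affine : ∀ c n → + (c ℕ.* n ℕ.+ 1) ≡ + c * + n + + 1
pos-affine c n = trans (ℤP.pos-+ (c ℕ.* n) 1) (cong (_+ + 1) (ℤP.pos-* c n))

pos-2n²+2n+1 : ∀ n → + (2 ℕ.* n ℕ.* n ℕ.+ 2 ℕ.* n ℕ.+ 1) ≡ + 2 * + n * + n + + 2 * + n + + 1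
pos-2n²+2n+1 n = begin
  + (2 ℕ.* n ℕ.* n ℕ.+ 2 ℕ.* n ℕ.+ 1)
    ≡⟨ ℤP.pos-+ (2 ℕ.* n ℕ.* n ℕ.+ 2 ℕ.* n) 1 ⟩
  + (2 ℕ.* n ℕ.* n ℕ.+ 2 ℕ.* n) + + 1
    ≡⟨ cong (_+ + 1) (ℤP.pos-+ (2 ℕ.* n ℕ.* n) (2 ℕ.* n)) ⟩
  + (2 ℕ.* n ℕ.* n) + + (2 ℕ.* n) + + 1
    ≡⟨ cong₂ (λ a b → a + b + + 1) (ℤP.pos-* (2 ℕ.* n) n) (ℤP.pos-* 2 n) ⟩
  + (2 ℕ.* n) * + n + + 2 * + n + + 1
    ≡⟨ cong (λ a → a * + n + + 2 * + n + + 1) (ℤP.pos-* 2 n) ⟩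
  + 2 * + n * + n + + 2 * + n + + 1 ∎

pos-quotient : ∀ {d m} .{{_ : ℕ.NonZero d}} → d ∣ m → + d * + (m / d) ≡ + m
pos-quotient {d} {m} d∣m = trans (sym (ℤP.pos-* d (m / d))) (cong +_ (m*[n/m]≡n d∣m))

ℤ-square⇒ℕ-square : ∀ {m} → Σ ℤ (λ w → w * w ≡ + m) → Σ ℕ λ s → s ℕ.* s ≡ m
ℤ-square⇒ℕ-square (w , w²≡m) = ℤ.∣ w ∣ , trans (sym (ℤP.abs-* w w)) (cong ℤ.∣_∣ w²≡m)

theorem4 : (n : ℕ) → n ≥ 1 → 5 ∣ (2 ℕ.* n ℕ.* n ℕ.+ 2 ℕ.* n ℕ.+ 1)
    → (¬ Σ ℕ (λ s → s ℕ.* s ≡ 8 ℕ.* n ℕ.+ 1))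
    → ((k : ℤ) → (+ (8 ℕ.* n)) ℤ.- (+ 3) ≢ (+ 5) ℤ.* k ℤ.* k)
    → ¬ Σ (Fin 5 → ℕ) (λ a →
          (Σ5 (λ g → + a g) ≡ + (2 ℕ.* n ℕ.+ 1))
          × ((λ g → + a g) ≋ ((λ g → + a g) ⁽ - (+ 1) ⁾))
          × (((λ g → + a g) · (λ g → + a g))
              ≋ (((+ 2 ℤ.* + ((2 ℕ.* n ℕ.* n ℕ.+ 2 ℕ.* n ℕ.+ 1) / 5)) ∙ C5)
                  ⊞ ((⊟ ((λ g → + a g) ⁽ + 2 ⁾)) ⊞ ι (+ (2 ℕ.* n))))))
theorem4 n _ 5∣2n²+2n+1 no-root no-k (a , Σa , a-sym , a-square) =
  [ (λ (w , w²≡8n+1) → no-root (ℤ-square⇒ℕ-square (w , trans w²≡8n+1 (sym (pos-affine 8 n)))))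
  , (λ (k , 8n-3≡5k²) → no-k k (trans (cong (_- + 3) (ℤP.pos-* 8 n)) 8n-3≡5k²))
  ] (reduced-system⇒8n+1≡w²⊎8n-3≡5k² {x} {y} {z} {+ m} {+ n} hS h₁ h₂ hQ)
  where
  m = (2 ℕ.* n ℕ.* n ℕ.+ 2 ℕ.* n ℕ.+ 1) / 5
  x = + a (# 0); y = + a (# 1); z = + a (# 2)
  reduced = symmetric-solution⇒reduced-system {c = + 2 * + m} {d = + (2 ℕ.* n)} a-sym a-square

  hS : x + + 2 * y + + 2 * z ≡ + 2 * + n + + 1
  hS = trans (sym (proj₁ reduced)) (trans Σa (pos-affine 2 n))

  h₁ : + 2 * x * y + + 2 * y * z + z * z + z ≡ + 2 * + m
  h₁ = proj₁ (proj₂ reduced)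

  h₂ : + 2 * x * z + y * y + + 2 * y * z + y ≡ + 2 * + m
  h₂ = proj₂ (proj₂ reduced)

  hQ : + 5 * + m ≡ + 2 * + n * + n + + 2 * + n + + 1
  hQ = trans (pos-quotient 5∣2n²+2n+1) (pos-2n²+2n+1 n)
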